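{- Let $\vartheta,\overline{\vartheta}:\{A,B,Z'\}\to\{0,1\}$ be given by $\vartheta(Z')=1,\vartheta(A)=1,\vartheta(B)=0$ and $\overline{\vartheta}(Z')=1,\overline{\vartheta}(A)=0,\overline{\vartheta}(B)=1$. Then $\vartheta(x)+\overline{\vartheta}(x)=1$ for $x\in\{A,B\}$. Furthermore, let $\rho,\overline{\rho}:\{A,B\}^+Z'\to[0,1]$ be given by $\rho(x_1x_2\cdots x_n)=\sum_{i=1}^n\vartheta(x_i)2^{ -i}$ and $\overline{\rho}(x_1x_2\cdots x_n)=\sum_{i=1}^n\overline{\vartheta}(x_i)2^{ -i}$. Then for any $(u'_{j_1},v'_{j_1}),\dots,(u'_{j_k},v'_{j_k})\in\{A,B\}^+\times\{A,B\}^+$, $$u'_{j_1}u'_{j_2}\cdots u'_{j_k}=v'_{j_1}v'_{j_2}\cdots v'_{j_k}$$ if and only if $$\rho(u'_{j_1}\cdots u'_{j_k}Z')+\overline{\rho}(v'_{j_1}\cdots v'_{j_k}Z')=1.$$ -}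

module Defs where

open import Data.Nat using (ℕ; zero; suc)
open import Data.List using (List; []; _∷_; _++_; [_])
open import Data.List.NonEmpty using (List⁺; toList; concat) renaming (map to map⁺)
open import Data.Product using (_×_; proj₁; proj₂)
open import Data.Rational using (ℚ; 0ℚ; 1ℚ; ½; _+_; _*_)

data Sym : Set where
  A B Z' : Sym

data Letter : Set where
  a b : Letter

ι : Letter → Sym
ι a = A
ι b = B

ϑ : Sym → ℕ
ϑ Z' = 1
ϑ A  = 1
ϑ B  = 0

ϑ̄ : Sym → ℕ
ϑ̄ Z' = 1
ϑ̄ A  = 0
ϑ̄ B  = 1

2^-_ : ℕ → ℚ
2^- zero  = 1ℚ
2^- suc n = ½ * (2^- n)

ℕ→ℚ : ℕ → ℚ
ℕ→ℚ zero    = 0ℚ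
ℕ→ℚ (suc n) = 1ℚ + ℕ→ℚ n

-- Σ_{i} f(x_i) 2^{-i}, where the first symbol of the list gets index (suc i)
weighted : (Sym → ℕ) → ℕ → List Sym → ℚ
weighted f i []       = 0ℚ
weighted f i (x ∷ xs) = ℕ→ℚ (f x) * (2^- suc i) + weighted f (suc i) xs

ρ : List Sym → ℚ
ρ = weighted ϑ 0

ρ̄ : List Sym → ℚ
ρ̄ = weighted ϑ̄ 0

Word⁺ : Set
Word⁺ = List⁺ Letter

_·Z' : Word⁺ → List Sym
w ·Z' = Data.List.map ι (toList w) ++ [ Z' ]

tops bottoms : List⁺ (Word⁺ × Word⁺) → Word⁺
tops    ps = concat (map⁺ proj₁ ps)
bottoms ps = concat (map⁺ proj₂ ps)

{-# OPTIONS --safe #-}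
-- Reading A as the binary digit 1 and B as 0, ρ(wZ') is the binary fraction 0.w₁⋯wₙ1,
-- and ρ̄(wZ') is the fraction with every letter digit flipped but the final 1 kept.
-- The two expansions add up to 0.1⋯11 + 0.0⋯01 = 1, so ρ(uZ') + ρ̄(vZ') = 1 says
-- exactly ρ(uZ') = ρ(vZ'), and a finite binary expansion ending in 1 is unique.
module Submission where

open import Defs
open import Data.Nat using (suc)
open import Data.List using (List; []; _∷_; _++_; [_]; map)
open import Data.List.NonEmpty using (List⁺; _∷_; toList)
open import Data.Product using (_×_; _,_; proj₁; proj₂)
open import Data.Rational using (ℚ; 0ℚ; 1ℚ; ½; _+_; _*_; _<_)
open import Data.Rational.Properties
  using (+-identityˡ; *-identityˡ; *-assoc; +-0-group; _<?_; <⇒≢; <-trans; +-monoʳ-<; *-monoʳ-<-pos)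
open import Data.Rational.Solver using (module +-*-Solver)
open import Algebra.Properties.Group +-0-group using (∙-cancelˡ; ∙-cancelʳ)
open import Data.Empty using (⊥-elim)
open import Relation.Nullary.Decidable using (toWitness)
open import Function.Bundles using (_⇔_; mk⇔)
open import Relation.Binary.PropositionalEquality
  using (_≡_; refl; sym; trans; cong; cong₂; module ≡-Reasoning)

open ≡-Reasoning

ϑ+ϑ̄≡1 : (x : Letter) → ϑ (ι x) Data.Nat.+ ϑ̄ (ι x) ≡ 1
ϑ+ϑ̄≡1 a = refl
ϑ+ϑ̄≡1 b = refl

½*-injective : ∀ {y z} → ½ * y ≡ ½ * z → y ≡ z
½*-injective {y} {z} eq = begin
  y                     ≡⟨ sym (*-identityˡ y) ⟩
  (2ℚ * ½) * y          ≡⟨ *-assoc 2ℚ ½ y ⟩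
  2ℚ * (½ * y)          ≡⟨ cong (2ℚ *_) eq ⟩
  2ℚ * (½ * z)          ≡⟨ sym (*-assoc 2ℚ ½ z) ⟩
  (2ℚ * ½) * z          ≡⟨ *-identityˡ z ⟩
  z                     ∎
  where
  2ℚ : ℚ
  2ℚ = 1ℚ + 1ℚ

weighted-suc : ∀ f i xs → weighted f (suc i) xs ≡ ½ * weighted f i xs
weighted-suc f i []       = refl
weighted-suc f i (x ∷ xs) = begin
  d * (½ * p) + weighted f (suc (suc i)) xs ≡⟨ cong (d * (½ * p) +_) (weighted-suc f (suc i) xs) ⟩
  d * (½ * p) + ½ * w                       ≡⟨ solve 3 (λ D P W → D :* (con ½ :* P) :+ con ½ :* W
                                                                   := con ½ :* (D :* P :+ W)) refl d p w ⟩
  ½ * (d * p + w)                           ∎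
  where
  open +-*-Solver
  d = ℕ→ℚ (f x)
  p = 2^- suc i
  w = weighted f (suc i) xs

weighted-∷ : ∀ f x xs → weighted f 0 (x ∷ xs) ≡ ℕ→ℚ (f x) * ½ + ½ * weighted f 0 xs
weighted-∷ f x xs = cong (ℕ→ℚ (f x) * ½ +_) (weighted-suc f 0 xs)

code : List Letter → List Sym
code w = map ι w ++ [ Z' ]

ρ-code-a : ∀ w → ρ (code (a ∷ w)) ≡ ½ + ½ * ρ (code w)
ρ-code-a w = weighted-∷ ϑ A (code w)

ρ-code-b : ∀ w → ρ (code (b ∷ w)) ≡ ½ * ρ (code w)
ρ-code-b w = trans (weighted-∷ ϑ B (code w)) (+-identityˡ _)

ρ+ρ̄-code : ∀ w → ρ (code w) + ρ̄ (code w) ≡ 1ℚ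
ρ+ρ̄-code []      = refl
ρ+ρ̄-code (x ∷ w) = begin
  ρ (code (x ∷ w)) + ρ̄ (code (x ∷ w))
    ≡⟨ cong₂ _+_ (weighted-∷ ϑ (ι x) (code w)) (weighted-∷ ϑ̄ (ι x) (code w)) ⟩
  (d + ½ * r) + (d̄ + ½ * r̄)
    ≡⟨ solve 4 (λ D D̄ R R̄ → (D :+ con ½ :* R) :+ (D̄ :+ con ½ :* R̄)
                             := (D :+ D̄) :+ con ½ :* (R :+ R̄)) refl d d̄ r r̄ ⟩
  (d + d̄) + ½ * (r + r̄)
    ≡⟨ cong (λ t → (d + d̄) + ½ * t) (ρ+ρ̄-code w) ⟩
  (d + d̄) + ½ * 1ℚ
    ≡⟨ digits-sum x ⟩
  1ℚ ∎
  where
  open +-*-Solver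
  d  = ℕ→ℚ (ϑ (ι x)) * ½
  d̄  = ℕ→ℚ (ϑ̄ (ι x)) * ½
  r  = ρ (code w)
  r̄  = ρ̄ (code w)
  digits-sum : ∀ x → (ℕ→ℚ (ϑ (ι x)) * ½ + ℕ→ℚ (ϑ̄ (ι x)) * ½) + ½ * 1ℚ ≡ 1ℚ
  digits-sum a = refl
  digits-sum b = refl

0<½ : 0ℚ < ½
0<½ = toWitness {a? = 0ℚ <? ½} _

½<1 : ½ < 1ℚ
½<1 = toWitness {a? = ½ <? 1ℚ} _

½*-pos : ∀ {y} → 0ℚ < y → 0ℚ < ½ * y
½*-pos = *-monoʳ-<-pos ½

½*-<½ : ∀ {y} → y < 1ℚ → ½ * y < ½
½*-<½ = *-monoʳ-<-pos ½

½<½+½* : ∀ {y} → 0ℚ < y → ½ < ½ + ½ * y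
½<½+½* 0<y = +-monoʳ-< ½ (½*-pos 0<y)

½+½*-<1 : ∀ {y} → y < 1ℚ → ½ + ½ * y < 1ℚ
½+½*-<1 y<1 = +-monoʳ-< ½ (½*-<½ y<1)

ρ-code-bounds : ∀ w → 0ℚ < ρ (code w) × ρ (code w) < 1ℚ
ρ-code-bounds []      = 0<½ , ½<1
ρ-code-bounds (a ∷ w) rewrite ρ-code-a w =
  <-trans 0<½ (½<½+½* (proj₁ (ρ-code-bounds w))) , ½+½*-<1 (proj₂ (ρ-code-bounds w))
ρ-code-bounds (b ∷ w) rewrite ρ-code-b w =
  ½*-pos (proj₁ (ρ-code-bounds w)) , <-trans (½*-<½ (proj₂ (ρ-code-bounds w))) ½<1

½<ρ-code-a : ∀ w → ½ < ρ (code (a ∷ w))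
½<ρ-code-a w rewrite ρ-code-a w = ½<½+½* (proj₁ (ρ-code-bounds w))

ρ-code-b<½ : ∀ w → ρ (code (b ∷ w)) < ½
ρ-code-b<½ w rewrite ρ-code-b w = ½*-<½ (proj₂ (ρ-code-bounds w))

-- The first letter is read off by comparing with ρ (code []) = ½.
ρ-code-injective : ∀ u v → ρ (code u) ≡ ρ (code v) → u ≡ v
ρ-code-injective []      []      eq = refl
ρ-code-injective []      (a ∷ v) eq = ⊥-elim (<⇒≢ (½<ρ-code-a v) eq)
ρ-code-injective []      (b ∷ v) eq = ⊥-elim (<⇒≢ (ρ-code-b<½ v) (sym eq))
ρ-code-injective (a ∷ u) []      eq = ⊥-elim (<⇒≢ (½<ρ-code-a u) (sym eq))
ρ-code-injective (b ∷ u) []      eq = ⊥-elim (<⇒≢ (ρ-code-b<½ u) eq)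
ρ-code-injective (a ∷ u) (b ∷ v) eq = ⊥-elim (<⇒≢ (<-trans (ρ-code-b<½ v) (½<ρ-code-a u)) (sym eq))
ρ-code-injective (b ∷ u) (a ∷ v) eq = ⊥-elim (<⇒≢ (<-trans (ρ-code-b<½ u) (½<ρ-code-a v)) eq)
ρ-code-injective (a ∷ u) (a ∷ v) eq = cong (a ∷_) (ρ-code-injective u v
  (½*-injective (∙-cancelˡ ½ _ _ (trans (sym (ρ-code-a u)) (trans eq (ρ-code-a v))))))
ρ-code-injective (b ∷ u) (b ∷ v) eq = cong (b ∷_) (ρ-code-injective u v
  (½*-injective (trans (sym (ρ-code-b u)) (trans eq (ρ-code-b v)))))

toList-injective : ∀ {A : Set} {u v : List⁺ A} → toList u ≡ toList v → u ≡ v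
toList-injective {u = _ ∷ _} {v = _ ∷ _} refl = refl

≡⇔ρ+ρ̄≡1 : ∀ (u v : Word⁺) → (u ≡ v) ⇔ (ρ (u ·Z') + ρ̄ (v ·Z') ≡ 1ℚ)
≡⇔ρ+ρ̄≡1 u v = mk⇔ to from
  where
  to : u ≡ v → ρ (u ·Z') + ρ̄ (v ·Z') ≡ 1ℚ
  to refl = ρ+ρ̄-code (toList u)

  from : ρ (u ·Z') + ρ̄ (v ·Z') ≡ 1ℚ → u ≡ v
  from eq = toList-injective (ρ-code-injective (toList u) (toList v)
    (∙-cancelʳ (ρ̄ (v ·Z')) _ _ (trans eq (sym (ρ+ρ̄-code (toList v))))))

lemma2 : ((x : Letter) → ϑ (ι x) Data.Nat.+ ϑ̄ (ι x) ≡ 1)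
    × ((ps : List⁺ (Word⁺ × Word⁺))
    → (tops ps ≡ bottoms ps) ⇔ (ρ (tops ps ·Z') + ρ̄ (bottoms ps ·Z') ≡ 1ℚ))
lemma2 = ϑ+ϑ̄≡1 , λ ps → ≡⇔ρ+ρ̄≡1 (tops ps) (bottoms ps)
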